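{- Let $n\ge 3$ and let $K_{1,n}$ be the star with $n$ leaves. The nullity pairs outside $\{(0,0),(1,0),(0,1)\}$ allowed by $K_{1,n}$ rooted at its center are precisely the pairs $(\ell-1,\ell)$ with $2\le\ell\le n$. The nullity pairs outside $\{(0,0),(1,0),(0,1)\}$ allowed by $K_{1,n}$ rooted at a leaf are precisely the pairs $(\ell,\ell)$ and $(\ell+1,\ell)$ with $1\le\ell\le n-2$.
   Context: All matrices are real. For a simple graph $G$ on $[n]$, $\mathcal{S}(G)$ is the set of real symmetric $n\times n$ matrices whose off-diagonal $(j,k)$ entry is nonzero iff $\{j,k\}\in E(G)$ (diagonal free). $A(i)$ is $A$ with row and column $i$ deleted. $(G,i)$ allows the nullity pair $(k,\ell)$ if some $A\in\mathcal{S}(G)$ has $(\operatorname{null}(A),\operatorname{null}(A(i)))=(k,\ell)$. -}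

module Defs where

open import Level using (0ℓ)
open import Data.Nat using (ℕ; zero; suc)
open import Data.Fin using (Fin; zero; suc; punchIn)
open import Data.Product using (Σ; _×_; _,_; ∃)
open import Data.Sum using (_⊎_)
open import Relation.Nullary using (¬_)
open import Relation.Binary.PropositionalEquality using (_≡_; _≢_)
open import Function.Bundles using (_⇔_)

-- The real numbers, axiomatised as a complete ordered field
-- (categorical: any two models are isomorphic).

record RealField : Set₁ where
  infixl 6 _+_
  infixl 7 _*_
  infix 4 _≤_
  field
    Carrier : Set
    0# 1#   : Carrier
    _+_ _*_ : Carrier → Carrier → Carrier
    -_      : Carrier → Carrier
    inv     : (x : Carrier) → x ≢ 0# → Carrier
    _≤_     : Carrier → Carrier → Set
    +-assoc   : ∀ x y z → (x + y) + z ≡ x + (y + z)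
    +-comm    : ∀ x y → x + y ≡ y + x
    +-identityˡ : ∀ x → 0# + x ≡ x
    -‿inverseˡ : ∀ x → (- x) + x ≡ 0#
    *-assoc   : ∀ x y z → (x * y) * z ≡ x * (y * z)
    *-comm    : ∀ x y → x * y ≡ y * x
    *-identityˡ : ∀ x → 1# * x ≡ x
    distribˡ  : ∀ x y z → x * (y + z) ≡ x * y + x * z
    inv-inverseˡ : ∀ x (p : x ≢ 0#) → inv x p * x ≡ 1#
    0≢1       : 0# ≢ 1#
    ≤-refl    : ∀ x → x ≤ x
    ≤-trans   : ∀ x y z → x ≤ y → y ≤ z → x ≤ z
    ≤-antisym : ∀ x y → x ≤ y → y ≤ x → x ≡ y
    ≤-total   : ∀ x y → x ≤ y ⊎ y ≤ x
    +-mono-≤  : ∀ x y z → x ≤ y → x + z ≤ y + z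
    *-nonneg  : ∀ x y → 0# ≤ x → 0# ≤ y → 0# ≤ x * y
    sup : (P : Carrier → Set) → Σ Carrier P →
          Σ Carrier (λ b → ∀ x → P x → x ≤ b) →
          Σ Carrier (λ s → (∀ x → P x → x ≤ s) ×
                           (∀ b → (∀ x → P x → x ≤ b) → s ≤ b))

record Graph (m : ℕ) : Set₁ where
  field
    Adj       : Fin m → Fin m → Set
    Adj-sym   : ∀ j k → Adj j k → Adj k j
    Adj-irrefl : ∀ j → ¬ Adj j j

-- The star K_{1,n} on vertex set Fin (suc n): vertex zero is the center,
-- vertices suc i (i : Fin n) are the n leaves.
starAdj : {n : ℕ} → Fin (suc n) → Fin (suc n) → Set
starAdj zero    zero    = Data.Empty.⊥ where import Data.Empty
starAdj zero    (suc _) = Data.Unit.⊤ where import Data.Unit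
starAdj (suc _) zero    = Data.Unit.⊤ where import Data.Unit
starAdj (suc _) (suc _) = Data.Empty.⊥ where import Data.Empty

star : (n : ℕ) → Graph (suc n)
star n = record { Adj = starAdj ; Adj-sym = sym' ; Adj-irrefl = irr }
  where
  sym' : ∀ j k → starAdj j k → starAdj k j
  sym' zero    (suc _) p = p
  sym' (suc _) zero    p = p
  irr : ∀ j → ¬ starAdj {n} j j
  irr zero    ()
  irr (suc _) ()

module _ (ℝ : RealField) where
  open RealField ℝ

  Matrix : ℕ → Set
  Matrix m = Fin m → Fin m → Carrier

  Vector : ℕ → Set
  Vector m = Fin m → Carrier

  sumF : {m : ℕ} → (Fin m → Carrier) → Carrier
  sumF {zero}  f = 0#
  sumF {suc m} f = f zero + sumF (λ k → f (suc k))

  InS : {m : ℕ} → Graph m → Matrix m → Set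
  InS G A = (∀ j k → A j k ≡ A k j) ×
            (∀ j k → j ≢ k → ((A j k ≢ 0#) ⇔ Graph.Adj G j k))

  deleteRC : {m : ℕ} → Fin (suc m) → Matrix (suc m) → Matrix m
  deleteRC i A j k = A (punchIn i j) (punchIn i k)

  InKernel : {m : ℕ} → Matrix m → Vector m → Set
  InKernel A v = ∀ j → sumF (λ k → A j k * v k) ≡ 0#

  LinIndep : {m r : ℕ} → (Fin r → Vector m) → Set
  LinIndep vs = ∀ (c : Fin _ → Carrier) →
                (∀ j → sumF (λ i → c i * vs i j) ≡ 0#) → ∀ i → c i ≡ 0#

  Nullity : {m : ℕ} → Matrix m → ℕ → Set
  Nullity {m} A k =
    Σ (Fin k → Vector m) (λ vs → (∀ i → InKernel A (vs i)) × LinIndep vs) ×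
    (∀ (ws : Fin (suc k) → Vector m) → (∀ i → InKernel A (ws i)) → ¬ LinIndep ws)

  Allows : {m : ℕ} → Graph (suc m) → Fin (suc m) → ℕ → ℕ → Set
  Allows G i k ℓ = Σ (Matrix _) (λ A → InS G A × Nullity A k × Nullity (deleteRC i A) ℓ)

Outside : ℕ → ℕ → Set
Outside k ℓ = ¬ ((k ≡ 0 × ℓ ≡ 0) ⊎ (k ≡ 1 × ℓ ≡ 0) ⊎ (k ≡ 0 × ℓ ≡ 1))

-- For A ∈ S(K_{1,n}) the submatrix A(0) obtained by deleting the center is the diagonal matrix
-- of the leaf entries d, so its nullity z is the number of zeros of d. If some d_p vanishes, the
-- row of leaf p forces every kernel vector of A to vanish at the center, and the kernel of A
-- becomes the hyperplane of ker A(0) orthogonal to the row b of spokes; since b_p ≠ 0 the unit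
-- vector at p is not in it, so null A = z − 1. If no d_p vanishes, null A(0) = 0 and interlacing,
-- |null A − null A(i)| ≤ 1, gives null A ≤ 1. Deleting a leaf i leaves a star matrix, and the same
-- dichotomy for A(i) together with interlacing yields the leaf-rooted pairs. All pairs are realised
-- by 0/1 leaf diagonals with a prescribed set of zeros. Equality of reals is not decidable, so the
-- case distinctions are made under double negation; this is harmless because the conclusions are
-- decidable statements about ℕ.
module Submission where

open import Defs
open import Level using (0ℓ)
open import Data.Nat as ℕ using (ℕ; zero; suc; _≤_; z≤n; s≤s)
open import Data.Fin using (Fin; zero; suc; punchIn; punchOut; _≟_; toℕ; inject≤; fromℕ<)
open import Data.Fin.Properties
  using ( punchInᵢ≢i; punchIn-punchOut; punchIn-injective; suc-injective
        ; toℕ-inject≤; inject≤-injective; toℕ<n; toℕ-injective; toℕ-fromℕ<)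
open import Data.Vec.Functional.Properties using (insertAt-punchIn; insertAt-lookup)
open import Data.Vec.Functional using (removeAt; insertAt; _∷_)
open import Data.Product using (Σ; ∃; _×_; _,_; proj₁; proj₂)
open import Data.Sum using (_⊎_; inj₁; inj₂; map₂)
open import Function using (_∘_)
open import Function.Bundles using (_⇔_; Equivalence; mk⇔)
open import Function.Definitions using (Injective)
open import Relation.Nullary using (¬_; yes; no; contradiction)
open import Relation.Nullary.Decidable using (toSum; ¬¬-excluded-middle)
open import Relation.Nullary.Negation using (¬¬-Monad; ¬∃⟶∀¬)
open import Relation.Unary using (_∩_; U)
open import Effect.Monad using (RawMonad)
open import Data.Unit using (tt)
open import Data.Nat.Properties using (≤⇒≤′; ≰⇒>; _≤?_; ≤-antisym; n≤0⇒n≡0)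
open import Relation.Binary.PropositionalEquality
  using (_≡_; _≢_; refl; sym; trans; cong; cong₂; subst; module ≡-Reasoning)
open import Algebra.Bundles using (CommutativeRing)
open import Algebra.Structures using (IsCommutativeRing)
open import Algebra.Consequences.Propositional using (comm∧idˡ⇒id; comm∧invˡ⇒inv; comm∧distrˡ⇒distrʳ)
open import Relation.Binary.PropositionalEquality.Algebra using (isMagma)
import Algebra.Properties.Semiring.Sum

open RawMonad (¬¬-Monad {0ℓ})

≡⊎punchIn : ∀ {m} (i t : Fin (suc m)) → t ≡ i ⊎ ∃ λ j → punchIn i j ≡ t
≡⊎punchIn i t with t ≟ i
... | yes t≡i = inj₁ t≡i
... | no t≢i  = inj₂ (punchOut (t≢i ∘ sym) , punchIn-punchOut (t≢i ∘ sym))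

¬¬-∀-Fin : ∀ {n} {P : Fin n → Set} → (∀ i → ¬ ¬ P i) → ¬ ¬ (∀ i → P i)
¬¬-∀-Fin {zero}  _   = pure λ ()
¬¬-∀-Fin {suc n} {P} ¬¬P = do
  P₀ ← ¬¬P zero
  Pₛ ← ¬¬-∀-Fin {P = P ∘ suc} (¬¬P ∘ suc)
  pure λ { zero → P₀ ; (suc i) → Pₛ i }

module _ (ℝ : RealField) where

  open RealField ℝ hiding (_≤_; ≤-refl; ≤-trans; ≤-antisym; ≤-total)

  isCommutativeRing : IsCommutativeRing _≡_ _+_ _*_ -_ 0# 1#
  isCommutativeRing = record
    { isRing = record
      { +-isAbelianGroup = record
        { isGroup = record
          { isMonoid = record
            { isSemigroup = record { isMagma = isMagma _+_ ; assoc = +-assoc }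
            ; identity = comm∧idˡ⇒id +-comm +-identityˡ }
          ; inverse = comm∧invˡ⇒inv +-comm -‿inverseˡ
          ; ⁻¹-cong = cong -_ }
        ; comm = +-comm }
      ; *-cong = cong₂ _*_
      ; *-assoc = *-assoc
      ; *-identity = comm∧idˡ⇒id *-comm *-identityˡ
      ; distrib = distribˡ , comm∧distrˡ⇒distrʳ *-comm distribˡ }
    ; *-comm = *-comm }

  commutativeRing : CommutativeRing 0ℓ 0ℓ
  commutativeRing = record { isCommutativeRing = isCommutativeRing }

  open CommutativeRing commutativeRing using (+-identityʳ; -‿inverseʳ; *-identityʳ; zeroˡ; zeroʳ)
  open import Algebra.Properties.Ring (CommutativeRing.ring commutativeRing) using (-‿distribˡ-*)
  open import Algebra.Properties.CommutativeSemigroup (CommutativeRing.*-commutativeSemigroup commutativeRing)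
    using (x∙yz≈y∙xz)
  private module Sum = Algebra.Properties.Semiring.Sum (CommutativeRing.semiring commutativeRing)
  open Sum using (sum)

  1≢0 : 1# ≢ 0#
  1≢0 = 0≢1 ∘ sym

  x≢0⇒x*y≡0⇒y≡0 : ∀ {x y} → x ≢ 0# → x * y ≡ 0# → y ≡ 0#
  x≢0⇒x*y≡0⇒y≡0 {x} {y} x≢0 xy≡0 = begin
    y                    ≡⟨ sym (*-identityˡ y) ⟩
    1# * y               ≡⟨ cong (_* y) (inv-inverseˡ x x≢0) ⟨
    (inv x x≢0 * x) * y  ≡⟨ *-assoc _ x y ⟩
    inv x x≢0 * (x * y)  ≡⟨ cong (inv x x≢0 *_) xy≡0 ⟩
    inv x x≢0 * 0#       ≡⟨ zeroʳ _ ⟩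
    0#                   ∎
    where open ≡-Reasoning

  x≡0⇒x+y≡0⇒y≡0 : ∀ {x y} → x ≡ 0# → x + y ≡ 0# → y ≡ 0#
  x≡0⇒x+y≡0⇒y≡0 {y = y} refl x+y≡0 = trans (sym (+-identityˡ y)) x+y≡0

  allZero⊎someNonzero : ∀ {n} (g : Fin n → Carrier) → ¬ ¬ ((∀ i → g i ≡ 0#) ⊎ ∃ λ i → g i ≢ 0#)
  allZero⊎someNonzero g = ¬¬-excluded-middle >>= λ where
    (yes nonzero) → pure (inj₂ nonzero)
    (no ¬nonzero) → inj₁ <$> ¬¬-∀-Fin (¬∃⟶∀¬ ¬nonzero)

  someZero⊎allNonzero : ∀ {n} (g : Fin n → Carrier) → ¬ ¬ ((∃ λ i → g i ≡ 0#) ⊎ ∀ i → g i ≢ 0#)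
  someZero⊎allNonzero g = map₂ ¬∃⟶∀¬ ∘ toSum <$> ¬¬-excluded-middle

  ∑ : ∀ {m} → Vector ℝ m → Carrier
  ∑ = sumF ℝ

  -- sumF and the library's sum recurse differently, so they agree only propositionally.
  ∑≡sum : ∀ {m} (f : Vector ℝ m) → ∑ f ≡ sum f
  ∑≡sum {zero}  f = refl
  ∑≡sum {suc m} f = cong (f zero +_) (∑≡sum (f ∘ suc))

  ∑-cong : ∀ {m} {f g : Vector ℝ m} → (∀ k → f k ≡ g k) → ∑ f ≡ ∑ g
  ∑-cong {f = f} {g} f≗g = trans (∑≡sum f) (trans (Sum.sum-cong-≗ f≗g) (sym (∑≡sum g)))

  ∑-zero : ∀ {m} {f : Vector ℝ m} → (∀ k → f k ≡ 0#) → ∑ f ≡ 0#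
  ∑-zero {m} {f} f≗0 = trans (∑≡sum f) (trans (Sum.sum-cong-≗ f≗0) (Sum.sum-replicate-zero m))

  ∑-remove : ∀ {m} (i : Fin (suc m)) (f : Vector ℝ (suc m)) → ∑ f ≡ f i + ∑ (removeAt f i)
  ∑-remove i f = trans (∑≡sum f) (trans (Sum.sum-remove f) (cong (f i +_) (sym (∑≡sum (removeAt f i)))))

  ∑-single : ∀ {m} (i : Fin m) (f : Vector ℝ m) → (∀ k → k ≢ i → f k ≡ 0#) → ∑ f ≡ f i
  ∑-single {suc m} i f f≡0 = begin
    ∑ f                      ≡⟨ ∑-remove i f ⟩
    f i + ∑ (removeAt f i)   ≡⟨ cong (f i +_) (∑-zero (λ k → f≡0 (punchIn i k) (punchInᵢ≢i i k))) ⟩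
    f i + 0#                 ≡⟨ +-identityʳ (f i) ⟩
    f i                      ∎
    where open ≡-Reasoning

  ∑-distrib-+ : ∀ {m} (f g : Vector ℝ m) → ∑ (λ k → f k + g k) ≡ ∑ f + ∑ g
  ∑-distrib-+ f g =
    trans (∑≡sum (λ k → f k + g k)) (trans (Sum.∑-distrib-+ f g) (sym (cong₂ _+_ (∑≡sum f) (∑≡sum g))))

  *-distribˡ-∑ : ∀ {m} x (f : Vector ℝ m) → x * ∑ f ≡ ∑ (λ k → x * f k)
  *-distribˡ-∑ x f =
    trans (cong (x *_) (∑≡sum f)) (trans (Sum.*-distribˡ-sum x f) (sym (∑≡sum (λ k → x * f k))))

  *-distribʳ-∑ : ∀ {m} x (f : Vector ℝ m) → ∑ f * x ≡ ∑ (λ k → f k * x)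
  *-distribʳ-∑ x f =
    trans (cong (_* x) (∑≡sum f)) (trans (Sum.*-distribʳ-sum x f) (sym (∑≡sum (λ k → f k * x))))

  ∑-comm : ∀ {m r} (F : Fin m → Fin r → Carrier) → ∑ (λ i → ∑ (F i)) ≡ ∑ (λ k → ∑ (λ i → F i k))
  ∑-comm F = begin
    ∑ (λ i → ∑ (F i))              ≡⟨ ∑-cong (λ i → ∑≡sum (F i)) ⟩
    ∑ (λ i → sum (F i))            ≡⟨ ∑≡sum (λ i → sum (F i)) ⟩
    sum (λ i → sum (F i))          ≡⟨ Sum.∑-comm F ⟩
    sum (λ k → sum (λ i → F i k))  ≡⟨ ∑≡sum (λ k → sum (λ i → F i k)) ⟨
    ∑ (λ k → sum (λ i → F i k))    ≡⟨ ∑-cong (λ k → ∑≡sum (λ i → F i k)) ⟨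
    ∑ (λ k → ∑ (λ i → F i k))      ∎
    where open ≡-Reasoning

  unit : ∀ {m} → Fin m → Vector ℝ m
  unit q k with k ≟ q
  ... | yes _ = 1#
  ... | no _  = 0#

  unit-≡ : ∀ {m} (q : Fin m) → unit q q ≡ 1#
  unit-≡ q with q ≟ q
  ... | yes _   = refl
  ... | no q≢q  = contradiction refl q≢q

  unit-≢ : ∀ {m} {q k : Fin m} → k ≢ q → unit q k ≡ 0#
  unit-≢ {q = q} {k} k≢q with k ≟ q
  ... | yes k≡q = contradiction k≡q k≢q
  ... | no _    = refl

  infix 7 _·_
  _·_ : ∀ {m} → Vector ℝ m → Vector ℝ m → Carrier
  w · v = ∑ (λ k → w k * v k)

  ·-unitʳ : ∀ {m} (w : Vector ℝ m) (q : Fin m) → w · unit q ≡ w q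
  ·-unitʳ w q = begin
    w · unit q      ≡⟨ ∑-single q _ (λ k k≢q → trans (cong (w k *_) (unit-≢ k≢q)) (zeroʳ (w k))) ⟩
    w q * unit q q  ≡⟨ cong (w q *_) (unit-≡ q) ⟩
    w q * 1#        ≡⟨ *-identityʳ (w q) ⟩
    w q             ∎
    where open ≡-Reasoning

  ·-unitˡ : ∀ {m} (q : Fin m) (v : Vector ℝ m) → unit q · v ≡ v q
  ·-unitˡ q v = trans (∑-cong (λ k → *-comm (unit q k) (v k))) (·-unitʳ v q)

  ·-zeroʳ : ∀ {m} (w v : Vector ℝ m) → (∀ k → v k ≡ 0#) → w · v ≡ 0#
  ·-zeroʳ w v v≡0 = ∑-zero (λ k → trans (cong (w k *_) (v≡0 k)) (zeroʳ (w k)))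

  ·-removeAt : ∀ {m} (i : Fin (suc m)) (w v : Vector ℝ (suc m)) → v i ≡ 0# →
               w · v ≡ removeAt w i · removeAt v i
  ·-removeAt i w v v-i≡0 = begin
    w · v                                   ≡⟨ ∑-remove i (λ k → w k * v k) ⟩
    w i * v i + removeAt w i · removeAt v i ≡⟨ cong (λ x → w i * x + removeAt w i · removeAt v i) v-i≡0 ⟩
    w i * 0# + removeAt w i · removeAt v i  ≡⟨ cong (_+ removeAt w i · removeAt v i) (zeroʳ (w i)) ⟩
    0# + removeAt w i · removeAt v i        ≡⟨ +-identityˡ _ ⟩
    removeAt w i · removeAt v i             ∎
    where open ≡-Reasoning

  ·-insertAt : ∀ {m} (i : Fin (suc m)) (w : Vector ℝ (suc m)) (v : Vector ℝ m) →
               w · insertAt v i 0# ≡ removeAt w i · v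
  ·-insertAt i w v = trans (·-removeAt i w (insertAt v i 0#) (insertAt-lookup v i 0#))
                           (∑-cong (λ k → cong (w (punchIn i k) *_) (insertAt-punchIn v i 0# k)))

  addScaled : ∀ {m} → Vector ℝ m → Carrier → Vector ℝ m → Vector ℝ m
  addScaled u μ v t = u t + μ * v t

  ·-addScaled : ∀ {m} (w u : Vector ℝ m) μ v → w · addScaled u μ v ≡ w · u + μ * (w · v)
  ·-addScaled w u μ v = begin
    ∑ (λ t → w t * (u t + μ * v t))
      ≡⟨ ∑-cong (λ t → trans (distribˡ (w t) _ _) (cong (w t * u t +_) (x∙yz≈y∙xz (w t) μ (v t)))) ⟩
    ∑ (λ t → w t * u t + μ * (w t * v t))    ≡⟨ ∑-distrib-+ (λ t → w t * u t) (λ t → μ * (w t * v t)) ⟩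
    w · u + ∑ (λ t → μ * (w t * v t))        ≡⟨ cong (w · u +_) (*-distribˡ-∑ μ (λ t → w t * v t)) ⟨
    w · u + μ * (w · v)                      ∎
    where open ≡-Reasoning

  ·-∑ : ∀ {m r} (w : Vector ℝ m) (c : Fin r → Carrier) (vs : Fin r → Vector ℝ m) →
        w · (λ t → ∑ (λ l → c l * vs l t)) ≡ ∑ (λ l → c l * (w · vs l))
  ·-∑ w c vs = begin
    ∑ (λ t → w t * ∑ (λ l → c l * vs l t))    ≡⟨ ∑-cong (λ t → *-distribˡ-∑ (w t) (λ l → c l * vs l t)) ⟩
    ∑ (λ t → ∑ (λ l → w t * (c l * vs l t)))  ≡⟨ ∑-comm (λ t l → w t * (c l * vs l t)) ⟩
    ∑ (λ l → ∑ (λ t → w t * (c l * vs l t)))  ≡⟨ ∑-cong (λ l → ∑-cong (λ t → x∙yz≈y∙xz (w t) (c l) (vs l t))) ⟩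
    ∑ (λ l → ∑ (λ t → c l * (w t * vs l t)))  ≡⟨ ∑-cong (λ l → *-distribˡ-∑ (c l) (λ t → w t * vs l t)) ⟨
    ∑ (λ l → c l * (w · vs l))                ∎
    where open ≡-Reasoning

  Independent : ∀ {m} → (Vector ℝ m → Set) → ℕ → Set
  Independent {m} P r = Σ (Fin r → Vector ℝ m) λ vs → (∀ l → P (vs l)) × LinIndep ℝ vs

  Independent-mono : ∀ {m r} (P Q : Vector ℝ m → Set) → (∀ {v} → P v → Q v) →
                     Independent P r → Independent Q r
  Independent-mono P Q P⇒Q (vs , P-vs , ind) = vs , P⇒Q ∘ P-vs , ind

  LinIndep-tail : ∀ {m r} (vs : Fin (suc r) → Vector ℝ m) → LinIndep ℝ vs → LinIndep ℝ (vs ∘ suc)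
  LinIndep-tail vs ind c h l =
    ind (0# ∷ c) (λ t → trans (cong₂ _+_ (zeroˡ (vs zero t)) (h t)) (+-identityˡ 0#)) (suc l)

  Independent-≤ : ∀ {m j r} {P : Vector ℝ m → Set} → j ≤ r → Independent P r → Independent P j
  Independent-≤ {m} {j} {P = P} j≤r = go (≤⇒≤′ j≤r)
    where
    go : ∀ {r} → j ℕ.≤′ r → Independent P r → Independent P j
    go ℕ.≤′-refl            I                 = I
    go (ℕ.≤′-step j≤′r) (vs , P-vs , ind) = go j≤′r (vs ∘ suc , P-vs ∘ suc , LinIndep-tail vs ind)

  Independent⇒≤ : ∀ {m j k} {P : Vector ℝ m → Set} → Independent P j → ¬ Independent P (suc k) → j ≤ k
  Independent⇒≤ {j = j} {k} {P} I ¬I with j ≤? k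
  ... | yes j≤k = j≤k
  ... | no  j≰k = contradiction (Independent-≤ {P = P} (≰⇒> j≰k) I) ¬I

  zero-member⇒¬LinIndep : ∀ {m r} (vs : Fin r → Vector ℝ m) (q : Fin r) →
                          (∀ t → vs q t ≡ 0#) → ¬ LinIndep ℝ vs
  zero-member⇒¬LinIndep vs q vs-q≡0 ind =
    1≢0 (trans (sym (unit-≡ q)) (ind (unit q) (λ t → trans (·-unitˡ q (λ l → vs l t)) (vs-q≡0 t)) q))

  LinIndep-cons : ∀ {m r} (w v : Vector ℝ m) {vs : Fin r → Vector ℝ m} →
                  w · v ≢ 0# → (∀ l → w · vs l ≡ 0#) → LinIndep ℝ vs → LinIndep ℝ (v ∷ vs)
  LinIndep-cons w v {vs} w·v≢0 w·vs≡0 ind c h = λ { zero → c₀≡0 ; (suc l) → cₛ≡0 l }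
    where
    open ≡-Reasoning
    c₀≡0 : c zero ≡ 0#
    c₀≡0 = x≢0⇒x*y≡0⇒y≡0 w·v≢0 (begin
      (w · v) * c zero                                            ≡⟨ *-comm (w · v) (c zero) ⟩
      c zero * (w · v)                                            ≡⟨ +-identityʳ _ ⟨
      c zero * (w · v) + 0#
        ≡⟨ cong (c zero * (w · v) +_) (∑-zero (λ l → trans (cong (c (suc l) *_) (w·vs≡0 l)) (zeroʳ _))) ⟨
      ∑ (λ i → c i * (w · (v ∷ vs) i))                            ≡⟨ ·-∑ w c (v ∷ vs) ⟨
      w · (λ t → ∑ (λ i → c i * (v ∷ vs) i t))                    ≡⟨ ·-zeroʳ w _ h ⟩
      0#                                                          ∎)
    cₛ≡0 : ∀ l → c (suc l) ≡ 0#
    cₛ≡0 = ind (c ∘ suc) (λ t → x≡0⇒x+y≡0⇒y≡0 (trans (cong (_* v t) c₀≡0) (zeroˡ (v t))) (h t))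

  LinIndep-removeAt : ∀ {m r} (vs : Fin r → Vector ℝ (suc m)) (i : Fin (suc m)) →
                      (∀ l → vs l i ≡ 0#) → LinIndep ℝ vs → LinIndep ℝ (λ l → removeAt (vs l) i)
  LinIndep-removeAt vs i vs-i≡0 ind c h = ind c (λ t → coordinate t (≡⊎punchIn i t))
    where
    coordinate : ∀ t → t ≡ i ⊎ ∃ (λ j → punchIn i j ≡ t) → ∑ (λ l → c l * vs l t) ≡ 0#
    coordinate _ (inj₁ refl)       = ∑-zero (λ l → trans (cong (c l *_) (vs-i≡0 l)) (zeroʳ (c l)))
    coordinate _ (inj₂ (j , refl)) = h j

  LinIndep-insertAt : ∀ {m r} (vs : Fin r → Vector ℝ m) (i : Fin (suc m)) →
                      LinIndep ℝ vs → LinIndep ℝ (λ l → insertAt (vs l) i 0#)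
  LinIndep-insertAt vs i ind c h =
    ind c λ k → trans (∑-cong (λ l → cong (c l *_) (sym (insertAt-punchIn (vs l) i 0# k)))) (h (punchIn i k))

  LinIndep-addScaled : ∀ {m r} (vs : Fin (suc r) → Vector ℝ m) (p : Fin (suc r))
                       (μ : Fin r → Carrier) → LinIndep ℝ vs →
                       LinIndep ℝ (λ i → addScaled (vs (punchIn p i)) (μ i) (vs p))
  LinIndep-addScaled vs p μ ind c h i =
    trans (sym (insertAt-punchIn c p S i)) (ind (insertAt c p S) combination (punchIn p i))
    where
    S = ∑ (λ i → c i * μ i)
    open ≡-Reasoning
    combination : ∀ t → ∑ (λ j → insertAt c p S j * vs j t) ≡ 0#
    combination t = begin
      ∑ (λ j → insertAt c p S j * vs j t)
        ≡⟨ ∑-remove p (λ j → insertAt c p S j * vs j t) ⟩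
      insertAt c p S p * vs p t + ∑ (λ i → insertAt c p S (punchIn p i) * vs (punchIn p i) t)
        ≡⟨ cong₂ _+_ (cong (_* vs p t) (insertAt-lookup c p S))
                     (∑-cong (λ i → cong (_* vs (punchIn p i) t) (insertAt-punchIn c p S i))) ⟩
      S * vs p t + ∑ (λ i → c i * vs (punchIn p i) t)
        ≡⟨ +-comm _ _ ⟩
      ∑ (λ i → c i * vs (punchIn p i) t) + S * vs p t
        ≡⟨ cong (∑ (λ i → c i * vs (punchIn p i) t) +_) (*-distribʳ-∑ (vs p t) (λ i → c i * μ i)) ⟩
      ∑ (λ i → c i * vs (punchIn p i) t) + ∑ (λ i → c i * μ i * vs p t)
        ≡⟨ ∑-distrib-+ (λ i → c i * vs (punchIn p i) t) (λ i → c i * μ i * vs p t) ⟨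
      ∑ (λ i → c i * vs (punchIn p i) t + c i * μ i * vs p t)
        ≡⟨ ∑-cong (λ i → trans (cong (c i * vs (punchIn p i) t +_) (*-assoc (c i) (μ i) (vs p t)))
                               (sym (distribˡ (c i) _ _))) ⟩
      ∑ (λ i → c i * addScaled (vs (punchIn p i)) (μ i) (vs p) t)
        ≡⟨ h t ⟩
      0# ∎

  Closed : ∀ {m} → (Vector ℝ m → Set) → Set
  Closed P = ∀ u μ v → P u → P v → P (addScaled u μ v)

  Linear : ∀ {m} → (Vector ℝ m → Carrier) → Set
  Linear f = ∀ u μ v → f (addScaled u μ v) ≡ f u + μ * f v

  eliminateAt : ∀ {m r} (P : Vector ℝ m → Set) (f : Vector ℝ m → Carrier) → Closed P → Linear f →
                (I : Independent P (suc r)) (p : Fin (suc r)) → f (proj₁ I p) ≢ 0# →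
                Independent (P ∩ λ v → f v ≡ 0#) r
  eliminateAt P f P-closed f-linear (vs , P-vs , ind) p f[vs-p]≢0 =
    ws , (λ i → P-closed (vs (punchIn p i)) (μ i) (vs p) (P-vs (punchIn p i)) (P-vs p) , f[ws]≡0 i) ,
    LinIndep-addScaled vs p μ ind
    where
    α = f (vs p)
    α⁻¹ = inv α f[vs-p]≢0
    μ : Fin _ → Carrier
    μ i = - (f (vs (punchIn p i)) * α⁻¹)
    ws : Fin _ → Vector ℝ _
    ws i = addScaled (vs (punchIn p i)) (μ i) (vs p)
    f[ws]≡0 : ∀ i → f (ws i) ≡ 0#
    f[ws]≡0 i = begin
      f (ws i)                ≡⟨ f-linear _ (μ i) (vs p) ⟩
      a + - (a * α⁻¹) * α     ≡⟨ cong (a +_) (-‿distribˡ-* (a * α⁻¹) α) ⟨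
      a + - (a * α⁻¹ * α)     ≡⟨ cong (λ x → a + - x) (*-assoc a α⁻¹ α) ⟩
      a + - (a * (α⁻¹ * α))   ≡⟨ cong (λ x → a + - (a * x)) (inv-inverseˡ α f[vs-p]≢0) ⟩
      a + - (a * 1#)          ≡⟨ cong (λ x → a + - x) (*-identityʳ a) ⟩
      a + - a                 ≡⟨ -‿inverseʳ a ⟩
      0#                      ∎
      where
      open ≡-Reasoning
      a = f (vs (punchIn p i))

  eliminate : ∀ {m r} (P : Vector ℝ m → Set) (f : Vector ℝ m → Carrier) → Closed P → Linear f →
              Independent P (suc r) → ¬ ¬ Independent (P ∩ λ v → f v ≡ 0#) r
  eliminate P f P-closed f-linear I@(vs , P-vs , ind) = allZero⊎someNonzero (f ∘ vs) >>= λ where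
    (inj₁ f[vs]≡0)         → pure (vs ∘ suc , (λ l → P-vs (suc l) , f[vs]≡0 (suc l)) , LinIndep-tail vs ind)
    (inj₂ (p , f[vs-p]≢0)) → pure (eliminateAt P f P-closed f-linear I p f[vs-p]≢0)

  ¬LinIndep-suc : ∀ m (vs : Fin (suc m) → Vector ℝ m) → ¬ LinIndep ℝ vs
  ¬LinIndep-suc zero    vs = zero-member⇒¬LinIndep vs zero (λ ())
  ¬LinIndep-suc (suc m) vs ind =
    eliminate U (λ v → v zero) (λ _ _ _ _ _ → tt) (λ _ _ _ → refl) (vs , (λ _ → tt) , ind) λ where
      (ws , ws-0 , ws-ind) →
        ¬LinIndep-suc m (λ l → removeAt (ws l) zero) (LinIndep-removeAt ws zero (proj₂ ∘ ws-0) ws-ind)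

  Independent⇒≤dim : ∀ {m r} {P : Vector ℝ m → Set} → Independent P r → r ≤ m
  Independent⇒≤dim {m} {P = P} I = Independent⇒≤ {P = P} I (λ (vs , _ , ind) → ¬LinIndep-suc m vs ind)

  ker : ∀ {m} → Matrix ℝ m → Vector ℝ m → Set
  ker = InKernel ℝ

  ker-closed : ∀ {m} (A : Matrix ℝ m) → Closed (ker A)
  ker-closed A u μ v Au≡0 Av≡0 j = begin
    A j · addScaled u μ v      ≡⟨ ·-addScaled (A j) u μ v ⟩
    A j · u + μ * (A j · v)    ≡⟨ cong₂ (λ x y → x + μ * y) (Au≡0 j) (Av≡0 j) ⟩
    0# + μ * 0#                ≡⟨ +-identityˡ _ ⟩
    μ * 0#                     ≡⟨ zeroʳ μ ⟩
    0#                         ∎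
    where open ≡-Reasoning

  nullity-basis : ∀ {m k} {A : Matrix ℝ m} → Nullity ℝ A k → Independent (ker A) k
  nullity-basis = proj₁

  nullity-bound : ∀ {m k} {A : Matrix ℝ m} → Nullity ℝ A k → ¬ Independent (ker A) (suc k)
  nullity-bound N (ws , ws-ker , ind) = proj₂ N ws ws-ker ind

  Nullity⇒≤ : ∀ {m j k} {A : Matrix ℝ m} → Nullity ℝ A k → Independent (ker A) j → j ≤ k
  Nullity⇒≤ {A = A} N I = Independent⇒≤ {P = ker A} I (nullity-bound N)

  offRow : ∀ {m} → Matrix ℝ (suc m) → Fin (suc m) → Vector ℝ m
  offRow A i = removeAt (A i) i

  removeAt-kernel : ∀ {m r} (A : Matrix ℝ (suc m)) (i : Fin (suc m)) →
                    Independent (ker A ∩ λ x → x i ≡ 0#) r →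
                    Independent (ker (deleteRC ℝ i A) ∩ λ y → offRow A i · y ≡ 0#) r
  removeAt-kernel A i (xs , xs-ker , ind) =
    (λ l → removeAt (xs l) i) , (λ l → row l ∘ punchIn i , row l i) ,
    LinIndep-removeAt xs i (proj₂ ∘ xs-ker) ind
    where
    row : ∀ l j → removeAt (A j) i · removeAt (xs l) i ≡ 0#
    row l j = trans (sym (·-removeAt i (A j) (xs l) (proj₂ (xs-ker l)))) (proj₁ (xs-ker l) j)

  insertAt-kernel : ∀ {m r} (A : Matrix ℝ (suc m)) (i : Fin (suc m)) →
                    Independent (ker (deleteRC ℝ i A) ∩ λ y → offRow A i · y ≡ 0#) r →
                    Independent (ker A) r
  insertAt-kernel A i (ys , ys-ker , ind) =
    (λ l → insertAt (ys l) i 0#) ,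
    (λ l t → trans (·-insertAt i (A t) (ys l)) (row l t (≡⊎punchIn i t))) ,
    LinIndep-insertAt ys i ind
    where
    row : ∀ l t → t ≡ i ⊎ ∃ (λ j → punchIn i j ≡ t) → removeAt (A t) i · ys l ≡ 0#
    row l _ (inj₁ refl)       = proj₂ (ys-ker l)
    row l _ (inj₂ (j , refl)) = proj₁ (ys-ker l) j

  interlacing-delete : ∀ {m r} (A : Matrix ℝ (suc m)) (i : Fin (suc m)) →
                       Independent (ker A) (suc r) → ¬ ¬ Independent (ker (deleteRC ℝ i A)) r
  interlacing-delete {r = r} A i I = forget <$> eliminate (ker A) (λ x → x i) (ker-closed A) (λ _ _ _ → refl) I
    where
    Aᵢ = deleteRC ℝ i A
    forget : Independent (ker A ∩ λ x → x i ≡ 0#) r → Independent (ker Aᵢ) r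
    forget J = Independent-mono (ker Aᵢ ∩ λ y → offRow A i · y ≡ 0#) (ker Aᵢ) proj₁ (removeAt-kernel A i J)

  interlacing-insert : ∀ {m r} (A : Matrix ℝ (suc m)) (i : Fin (suc m)) →
                       Independent (ker (deleteRC ℝ i A)) (suc r) → ¬ ¬ Independent (ker A) r
  interlacing-insert A i I =
    insertAt-kernel A i <$> eliminate (ker Aᵢ) (offRow A i ·_) (ker-closed Aᵢ) (·-addScaled (offRow A i)) I
    where Aᵢ = deleteRC ℝ i A

  nullity-interlacing : ∀ {m k ℓ} (A : Matrix ℝ (suc m)) (i : Fin (suc m)) →
                        Nullity ℝ A k → Nullity ℝ (deleteRC ℝ i A) ℓ → k ≤ suc ℓ × ℓ ≤ suc k
  nullity-interlacing A i NA NAᵢ =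
    Independent⇒≤ {P = ker A} (nullity-basis {A = A} NA)
                  (λ I → interlacing-delete A i I (nullity-bound {A = Aᵢ} NAᵢ)) ,
    Independent⇒≤ {P = ker Aᵢ} (nullity-basis {A = Aᵢ} NAᵢ)
                  (λ I → interlacing-insert A i I (nullity-bound {A = A} NA))
    where Aᵢ = deleteRC ℝ i A

  record IsDiagonal {N} (D : Matrix ℝ N) (d : Vector ℝ N) : Set where
    field
      offDiagonal : ∀ j k → j ≢ k → D j k ≡ 0#
      diagonal    : ∀ j → D j j ≡ d j

  IsDiagonal-symmetric : ∀ {N} {D : Matrix ℝ N} {d} → IsDiagonal D d → ∀ j k → D j k ≡ D k j
  IsDiagonal-symmetric isD j k with j ≟ k
  ... | yes refl = refl
  ... | no j≢k   = trans (offDiagonal j k j≢k) (sym (offDiagonal k j (j≢k ∘ sym)))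
    where open IsDiagonal isD

  IsDiagonal-deleteRC : ∀ {N} {D : Matrix ℝ (suc N)} {d d′} → IsDiagonal D d → ∀ i →
                        (∀ j → d (punchIn i j) ≡ d′ j) → IsDiagonal (deleteRC ℝ i D) d′
  IsDiagonal-deleteRC isD i d∘punchIn≡d′ = record
    { offDiagonal = λ j k j≢k → offDiagonal (punchIn i j) (punchIn i k) (j≢k ∘ punchIn-injective i j k)
    ; diagonal    = λ j → trans (diagonal (punchIn i j)) (d∘punchIn≡d′ j)
    }
    where open IsDiagonal isD

  diagonalMatrix : ∀ {N} → Vector ℝ N → Matrix ℝ N
  diagonalMatrix d j k with j ≟ k
  ... | yes _ = d j
  ... | no _  = 0#

  diagonalMatrix-IsDiagonal : ∀ {N} (d : Vector ℝ N) → IsDiagonal (diagonalMatrix d) d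
  diagonalMatrix-IsDiagonal d = record { offDiagonal = offDiagonal ; diagonal = diagonal }
    where
    offDiagonal : ∀ j k → j ≢ k → diagonalMatrix d j k ≡ 0#
    offDiagonal j k j≢k with j ≟ k
    ... | yes j≡k = contradiction j≡k j≢k
    ... | no _    = refl
    diagonal : ∀ j → diagonalMatrix d j j ≡ d j
    diagonal j with j ≟ j
    ... | yes _   = refl
    ... | no j≢j  = contradiction refl j≢j

  record ZeroPattern {N} (d : Vector ℝ N) (z : ℕ) : Set where
    field
      position           : Fin z → Fin N
      position-injective : Injective _≡_ _≡_ position
      zero-at            : ∀ q → d (position q) ≡ 0#
      zero⊎nonzero       : ∀ t → (∃ λ q → position q ≡ t) ⊎ d t ≢ 0#

  nonzero⇒ZeroPattern : ∀ {N} {d : Vector ℝ N} → (∀ t → d t ≢ 0#) → ZeroPattern d 0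
  nonzero⇒ZeroPattern d≢0 = record
    { position = λ () ; position-injective = λ {} ; zero-at = λ () ; zero⊎nonzero = inj₂ ∘ d≢0 }

  prefixZeros : ∀ {N} → ℕ → Vector ℝ N
  prefixZeros z t with toℕ t ℕ.<? z
  ... | yes _ = 0#
  ... | no _  = 1#

  prefixZeros-ZeroPattern : ∀ {N z} → z ≤ N → ZeroPattern (prefixZeros {N} z) z
  prefixZeros-ZeroPattern {N} {z} z≤N = record
    { position           = position
    ; position-injective = inject≤-injective z≤N z≤N _ _
    ; zero-at            = zero-at
    ; zero⊎nonzero       = zero⊎nonzero
    }
    where
    position : Fin z → Fin N
    position q = inject≤ q z≤N
    zero-at : ∀ q → prefixZeros z (position q) ≡ 0#
    zero-at q with toℕ (position q) ℕ.<? z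
    ... | yes _  = refl
    ... | no ≮z  = contradiction (subst (ℕ._< z) (sym (toℕ-inject≤ q z≤N)) (toℕ<n q)) ≮z
    zero⊎nonzero : ∀ t → (∃ λ q → position q ≡ t) ⊎ prefixZeros z t ≢ 0#
    zero⊎nonzero t with toℕ t ℕ.<? z
    ... | yes t<z = inj₁ (fromℕ< t<z , toℕ-injective (trans (toℕ-inject≤ (fromℕ< t<z) z≤N) (toℕ-fromℕ< t<z)))
    ... | no _    = inj₂ 1≢0

  module _ {N z} {d : Vector ℝ N} (zp : ZeroPattern d z) (i : Fin (suc N)) where
    open ZeroPattern zp

    zero⊎nonzero-punchIn : ∀ {e} j → (∃ λ q → punchIn i (position q) ≡ punchIn i j) ⊎
                                     insertAt d i e (punchIn i j) ≢ 0#
    zero⊎nonzero-punchIn {e} j with zero⊎nonzero j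
    ... | inj₁ (q , refl) = inj₁ (q , refl)
    ... | inj₂ d-j≢0      = inj₂ (d-j≢0 ∘ trans (sym (insertAt-punchIn d i e j)))

    ZeroPattern-insertAt-nonzero : ∀ {e} → e ≢ 0# → ZeroPattern (insertAt d i e) z
    ZeroPattern-insertAt-nonzero {e} e≢0 = record
      { position           = punchIn i ∘ position
      ; position-injective = position-injective ∘ punchIn-injective i _ _
      ; zero-at            = λ q → trans (insertAt-punchIn d i e (position q)) (zero-at q)
      ; zero⊎nonzero       = λ t → cover t (≡⊎punchIn i t)
      }
      where
      cover : ∀ t → t ≡ i ⊎ ∃ (λ j → punchIn i j ≡ t) →
              (∃ λ q → punchIn i (position q) ≡ t) ⊎ insertAt d i e t ≢ 0#
      cover _ (inj₁ refl)       = inj₂ (e≢0 ∘ trans (sym (insertAt-lookup d i e)))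
      cover _ (inj₂ (j , refl)) = zero⊎nonzero-punchIn j

    ZeroPattern-insertAt-zero : ZeroPattern (insertAt d i 0#) (suc z)
    ZeroPattern-insertAt-zero = record
      { position           = position′
      ; position-injective = injective
      ; zero-at            = λ { zero    → insertAt-lookup d i 0#
                               ; (suc q) → trans (insertAt-punchIn d i 0# (position q)) (zero-at q) }
      ; zero⊎nonzero       = λ t → cover t (≡⊎punchIn i t)
      }
      where
      position′ : Fin (suc z) → Fin (suc N)
      position′ = i ∷ (punchIn i ∘ position)
      injective : Injective _≡_ _≡_ position′
      injective {zero}  {zero}  _  = refl
      injective {zero}  {suc q} eq = contradiction (sym eq) (punchInᵢ≢i i (position q))
      injective {suc q} {zero}  eq = contradiction eq (punchInᵢ≢i i (position q))
      injective {suc q} {suc r} eq = cong suc (position-injective (punchIn-injective i _ _ eq))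
      cover : ∀ t → t ≡ i ⊎ ∃ (λ j → punchIn i j ≡ t) →
              (∃ λ q → position′ q ≡ t) ⊎ insertAt d i 0# t ≢ 0#
      cover _ (inj₁ refl)       = inj₁ (zero , refl)
      cover _ (inj₂ (j , refl)) with zero⊎nonzero-punchIn {0#} j
      ... | inj₁ (q , eq)  = inj₁ (suc q , eq)
      ... | inj₂ ≢0        = inj₂ ≢0

  module _ {N} {D : Matrix ℝ N} {d : Vector ℝ N} (isD : IsDiagonal D d) where
    open IsDiagonal isD

    IsDiagonal-row· : ∀ j y → D j · y ≡ d j * y j
    IsDiagonal-row· j y = begin
      D j · y      ≡⟨ ∑-single j _ (λ k k≢j → trans (cong (_* y k) (offDiagonal j k (k≢j ∘ sym))) (zeroˡ _)) ⟩
      D j j * y j  ≡⟨ cong (_* y j) (diagonal j) ⟩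
      d j * y j    ∎
      where open ≡-Reasoning

    diagonal-kernel : ∀ {y} → ker D y → ∀ j → d j * y j ≡ 0#
    diagonal-kernel {y} y∈ker j = trans (sym (IsDiagonal-row· j y)) (y∈ker j)

    zero⇒unit∈ker : ∀ {p} → d p ≡ 0# → ker D (unit p)
    zero⇒unit∈ker {p} d-p≡0 j = trans (·-unitʳ (D j) p) (column≡0 j)
      where
      column≡0 : ∀ j → D j p ≡ 0#
      column≡0 j with j ≟ p
      ... | yes refl = trans (diagonal j) d-p≡0
      ... | no j≢p   = offDiagonal j p j≢p

    module _ {z} (zp : ZeroPattern d z) where
      open ZeroPattern zp

      ZeroPattern-basis : Independent (ker D) z
      ZeroPattern-basis = unit ∘ position , zero⇒unit∈ker ∘ zero-at , ind
        where
        ind : LinIndep ℝ (unit ∘ position)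
        ind c h q = begin
          c q                                               ≡⟨ *-identityʳ (c q) ⟨
          c q * 1#                                          ≡⟨ cong (c q *_) (unit-≡ (position q)) ⟨
          c q * unit (position q) (position q)
            ≡⟨ ∑-single q _ (λ q′ q′≢q → trans (cong (c q′ *_) (unit-≢ (q′≢q ∘ position-injective ∘ sym)))
                                              (zeroʳ _)) ⟨
          ∑ (λ q′ → c q′ * unit (position q′) (position q)) ≡⟨ h (position q) ⟩
          0#                                                ∎
          where open ≡-Reasoning

      ZeroPattern-bound : ¬ Independent (ker D) (suc z)
      ZeroPattern-bound (vs , vs-ker , ind) =
        ¬LinIndep-suc z (λ l q → vs l (position q)) λ c h → ind c λ t → coordinate c h t (zero⊎nonzero t)
        where
        coordinate : ∀ c → (∀ q → ∑ (λ l → c l * vs l (position q)) ≡ 0#) →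
                     ∀ t → (∃ λ q → position q ≡ t) ⊎ d t ≢ 0# → ∑ (λ l → c l * vs l t) ≡ 0#
        coordinate c h _ (inj₁ (q , refl)) = h q
        coordinate c h t (inj₂ d-t≢0)      =
          ∑-zero (λ l → trans (cong (c l *_) (x≢0⇒x*y≡0⇒y≡0 d-t≢0 (diagonal-kernel (vs-ker l) t))) (zeroʳ (c l)))

      ZeroPattern-nullity : Nullity ℝ D z
      ZeroPattern-nullity = ZeroPattern-basis , λ ws ws-ker ind → ZeroPattern-bound (ws , ws-ker , ind)

  -- What the argument uses of A ∈ S(K_{1,n}); InS only yields ¬ ¬ (A j k ≡ 0) for distinct leaves.
  record StarPattern {m} (M : Matrix ℝ (suc m)) : Set where
    field
      leaf-offDiagonal : ∀ j k → j ≢ k → M (suc j) (suc k) ≡ 0#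
      spokeʳ           : ∀ j → M zero (suc j) ≢ 0#
      spokeˡ           : ∀ j → M (suc j) zero ≢ 0#

  InS⇒StarPattern : ∀ {n} (A : Matrix ℝ (suc n)) → InS ℝ (star n) A → ¬ ¬ StarPattern A
  InS⇒StarPattern A (_ , adjacency) = (λ off → record
    { leaf-offDiagonal = off
    ; spokeʳ = λ j → Equivalence.from (adjacency zero (suc j) λ ()) tt
    ; spokeˡ = λ j → Equivalence.from (adjacency (suc j) zero λ ()) tt
    }) <$> ¬¬-∀-Fin (λ j → ¬¬-∀-Fin (offDiagonal j))
    where
    offDiagonal : ∀ j k → ¬ ¬ (j ≢ k → A (suc j) (suc k) ≡ 0#)
    offDiagonal j k with j ≟ k
    ... | yes refl = pure (λ j≢j → contradiction refl j≢j)
    ... | no j≢k   = λ ¬off →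
      Equivalence.to (adjacency (suc j) (suc k) (j≢k ∘ suc-injective)) (λ Ajk≡0 → ¬off (λ _ → Ajk≡0))

  StarPattern-deleteLeaf : ∀ {m} {M : Matrix ℝ (suc (suc m))} → StarPattern M →
                           ∀ i → StarPattern (deleteRC ℝ (suc i) M)
  StarPattern-deleteLeaf SP i = record
    { leaf-offDiagonal = λ j k j≢k → leaf-offDiagonal (punchIn i j) (punchIn i k) (j≢k ∘ punchIn-injective i j k)
    ; spokeʳ = spokeʳ ∘ punchIn i
    ; spokeˡ = spokeˡ ∘ punchIn i
    }
    where open StarPattern SP

  StarPattern-IsDiagonal : ∀ {m} {M : Matrix ℝ (suc m)} → StarPattern M →
                           IsDiagonal (deleteRC ℝ zero M) (λ j → M (suc j) (suc j))
  StarPattern-IsDiagonal SP = record { offDiagonal = StarPattern.leaf-offDiagonal SP ; diagonal = λ _ → refl }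

  nonzeroLeaves⇒nullity-deleteCenter : ∀ {m} {M : Matrix ℝ (suc m)} → StarPattern M →
                                       (∀ p → M (suc p) (suc p) ≢ 0#) → Nullity ℝ (deleteRC ℝ zero M) 0
  nonzeroLeaves⇒nullity-deleteCenter SP Mpp≢0 = ZeroPattern-nullity (StarPattern-IsDiagonal SP) (nonzero⇒ZeroPattern Mpp≢0)

  offRow-leaf·≡0 : ∀ {m} {M : Matrix ℝ (suc (suc m))} → StarPattern M →
                   ∀ i {y} → y zero ≡ 0# → offRow M (suc i) · y ≡ 0#
  offRow-leaf·≡0 {M = M} SP i {y} y₀≡0 = begin
    M (suc i) zero * y zero + ∑ (λ j → M (suc i) (suc (punchIn i j)) * y (suc j))
      ≡⟨ cong₂ _+_ (trans (cong (M (suc i) zero *_) y₀≡0) (zeroʳ _))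
                   (∑-zero (λ j → trans (cong (_* y (suc j)) (off i (punchIn i j) (punchInᵢ≢i i j ∘ sym))) (zeroˡ _))) ⟩
    0# + 0#  ≡⟨ +-identityˡ 0# ⟩
    0#       ∎
    where
    open ≡-Reasoning
    off : ∀ j k → j ≢ k → M (suc j) (suc k) ≡ 0#
    off = StarPattern.leaf-offDiagonal SP

  module _ {m} {M : Matrix ℝ (suc m)} (SP : StarPattern M) where
    open StarPattern SP

    zeroLeaf⇒kernel-center≡0 : ∀ {p x} → M (suc p) (suc p) ≡ 0# → ker M x → x zero ≡ 0#
    zeroLeaf⇒kernel-center≡0 {p} {x} Mpp≡0 x∈ker = x≢0⇒x*y≡0⇒y≡0 (spokeˡ p) (begin
      M (suc p) zero * x zero                                   ≡⟨ +-identityʳ _ ⟨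
      M (suc p) zero * x zero + 0#                              ≡⟨ cong (M (suc p) zero * x zero +_) leaves ⟨
      M (suc p) zero * x zero + deleteRC ℝ zero M p · (x ∘ suc) ≡⟨ x∈ker (suc p) ⟩
      0#                                                        ∎)
      where
      open ≡-Reasoning
      leaves : deleteRC ℝ zero M p · (x ∘ suc) ≡ 0#
      leaves = trans (IsDiagonal-row· (StarPattern-IsDiagonal SP) p (x ∘ suc))
                     (trans (cong (_* x (suc p)) Mpp≡0) (zeroˡ _))

    offRow-center·unit≢0 : ∀ p → offRow M zero · unit p ≢ 0#
    offRow-center·unit≢0 p eq = spokeʳ p (trans (sym (·-unitʳ (offRow M zero) p)) eq)

    zeroLeaf⇒Independent-deleteCenter : ∀ {p r} → M (suc p) (suc p) ≡ 0# →
                                        Independent (ker M) r → Independent (ker (deleteRC ℝ zero M)) (suc r)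
    zeroLeaf⇒Independent-deleteCenter {p} {r} Mpp≡0 I =
      extend (removeAt-kernel M zero (Independent-mono (ker M) (ker M ∩ λ x → x zero ≡ 0#)
        (λ {x} x∈ker → x∈ker , zeroLeaf⇒kernel-center≡0 {x = x} Mpp≡0 x∈ker) I))
      where
      extend : Independent (ker (deleteRC ℝ zero M) ∩ λ y → offRow M zero · y ≡ 0#) r →
               Independent (ker (deleteRC ℝ zero M)) (suc r)
      extend (ys , ys-ker , ind) =
        unit p ∷ ys ,
        (λ { zero → zero⇒unit∈ker (StarPattern-IsDiagonal SP) Mpp≡0 ; (suc l) → proj₁ (ys-ker l) }) ,
        LinIndep-cons (offRow M zero) (unit p) (offRow-center·unit≢0 p) (proj₂ ∘ ys-ker) ind

  starNullity : ∀ {m k} {M : Matrix ℝ (suc m)} {d : Vector ℝ m} → StarPattern M →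
                IsDiagonal (deleteRC ℝ zero M) d → ZeroPattern d (suc k) → Nullity ℝ M k
  starNullity {k = k} {M} SP isD zp = insertAt-kernel M zero basis , λ ws ws-ker ind →
    ZeroPattern-bound isD zp (zeroLeaf⇒Independent-deleteCenter SP Mpp≡0 (ws , ws-ker , ind))
    where
    open ZeroPattern zp
    D = deleteRC ℝ zero M
    p = position zero
    Mpp≡0 : M (suc p) (suc p) ≡ 0#
    Mpp≡0 = trans (IsDiagonal.diagonal isD p) (zero-at zero)
    basis : Independent (ker D ∩ λ y → offRow M zero · y ≡ 0#) k
    basis = eliminateAt (ker D) (offRow M zero ·_) (ker-closed D) (·-addScaled (offRow M zero))
                        (ZeroPattern-basis isD zp) zero (offRow-center·unit≢0 SP p)

  starMatrix : ∀ {n} → Vector ℝ n → Matrix ℝ (suc n)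
  starMatrix d zero    zero    = 0#
  starMatrix d zero    (suc _) = 1#
  starMatrix d (suc _) zero    = 1#
  starMatrix d (suc j) (suc k) = diagonalMatrix d j k

  starMatrix-InS : ∀ {n} (d : Vector ℝ n) → InS ℝ (star n) (starMatrix d)
  starMatrix-InS {n} d = symmetric , adjacency
    where
    isD : IsDiagonal (diagonalMatrix d) d
    isD = diagonalMatrix-IsDiagonal d
    symmetric : ∀ j k → starMatrix d j k ≡ starMatrix d k j
    symmetric zero    zero    = refl
    symmetric zero    (suc k) = refl
    symmetric (suc j) zero    = refl
    symmetric (suc j) (suc k) = IsDiagonal-symmetric isD j k
    adjacency : ∀ j k → j ≢ k → (starMatrix d j k ≢ 0#) ⇔ Graph.Adj (star n) j k
    adjacency zero    zero    0≢0 = contradiction refl 0≢0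
    adjacency zero    (suc k) _   = mk⇔ (λ _ → tt) (λ _ → 1≢0)
    adjacency (suc j) zero    _   = mk⇔ (λ _ → tt) (λ _ → 1≢0)
    adjacency (suc j) (suc k) j≢k = mk⇔ (λ ≢0 → ≢0 (IsDiagonal.offDiagonal isD j k (j≢k ∘ cong suc))) λ ()

  starMatrix-StarPattern : ∀ {n} (d : Vector ℝ n) → StarPattern (starMatrix d)
  starMatrix-StarPattern d = record
    { leaf-offDiagonal = IsDiagonal.offDiagonal (diagonalMatrix-IsDiagonal d)
    ; spokeʳ           = λ _ → 1≢0
    ; spokeˡ           = λ _ → 1≢0
    }

  centerPairs : ∀ {n k ℓ} (A : Matrix ℝ (suc n)) → StarPattern A →
                Nullity ℝ A k → Nullity ℝ (deleteRC ℝ zero A) ℓ →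
                ¬ ¬ ((suc k ≡ ℓ × ℓ ≤ n) ⊎ (ℓ ≡ 0 × k ≤ 1))
  centerPairs {n} {k} {ℓ} A SP NA NAᵢ = cases <$> someZero⊎allNonzero (λ p → A (suc p) (suc p))
    where
    Aᵢ = deleteRC ℝ zero A
    interlacing : k ≤ suc ℓ × ℓ ≤ suc k
    interlacing = nullity-interlacing A zero NA NAᵢ
    cases : (∃ λ p → A (suc p) (suc p) ≡ 0#) ⊎ (∀ p → A (suc p) (suc p) ≢ 0#) →
            (suc k ≡ ℓ × ℓ ≤ n) ⊎ (ℓ ≡ 0 × k ≤ 1)
    cases (inj₁ (p , App≡0)) =
      inj₁ (≤-antisym 1+k≤ℓ (proj₂ interlacing) , Independent⇒≤dim {P = ker Aᵢ} (nullity-basis {A = Aᵢ} NAᵢ))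
      where
      1+k≤ℓ : suc k ≤ ℓ
      1+k≤ℓ = Nullity⇒≤ NAᵢ (zeroLeaf⇒Independent-deleteCenter SP App≡0 (nullity-basis {A = A} NA))
    cases (inj₂ App≢0) = inj₂ (ℓ≡0 , subst (λ x → k ≤ suc x) ℓ≡0 (proj₁ interlacing))
      where
      ℓ≡0 : ℓ ≡ 0
      ℓ≡0 = n≤0⇒n≡0 (Nullity⇒≤ (nonzeroLeaves⇒nullity-deleteCenter SP App≢0) (nullity-basis {A = Aᵢ} NAᵢ))

  leafPairs : ∀ {m k ℓ} (A : Matrix ℝ (suc (suc m))) (i : Fin (suc m)) → StarPattern A →
              Nullity ℝ A k → Nullity ℝ (deleteRC ℝ (suc i) A) ℓ →
              ¬ ¬ (k ≤ suc ℓ × ((ℓ ≤ k × suc ℓ ≤ m) ⊎ ℓ ≤ 1))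
  leafPairs {m} {k} {ℓ} A i SP NA NAᵢ =
    (proj₁ (nullity-interlacing A (suc i) NA NAᵢ) ,_) ∘ cases <$> someZero⊎allNonzero (λ p → Aᵢ (suc p) (suc p))
    where
    Aᵢ = deleteRC ℝ (suc i) A
    SPᵢ = StarPattern-deleteLeaf SP i
    cases : (∃ λ p → Aᵢ (suc p) (suc p) ≡ 0#) ⊎ (∀ p → Aᵢ (suc p) (suc p) ≢ 0#) → (ℓ ≤ k × suc ℓ ≤ m) ⊎ ℓ ≤ 1
    cases (inj₁ (p , Aᵢpp≡0)) = inj₁ (Nullity⇒≤ {A = A} NA lifted , Independent⇒≤dim {P = ker (deleteRC ℝ zero Aᵢ)} grown)
      where
      grown : Independent (ker (deleteRC ℝ zero Aᵢ)) (suc ℓ)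
      grown = zeroLeaf⇒Independent-deleteCenter SPᵢ Aᵢpp≡0 (nullity-basis {A = Aᵢ} NAᵢ)
      lifted : Independent (ker A) ℓ
      lifted = insertAt-kernel A (suc i) (Independent-mono (ker Aᵢ) (ker Aᵢ ∩ λ y → offRow A (suc i) · y ≡ 0#)
        (λ {y} y∈ker → y∈ker , offRow-leaf·≡0 SP i {y} (zeroLeaf⇒kernel-center≡0 SPᵢ {x = y} Aᵢpp≡0 y∈ker))
        (nullity-basis {A = Aᵢ} NAᵢ))
    cases (inj₂ Aᵢpp≢0) =
      inj₂ (proj₁ (nullity-interlacing Aᵢ zero NAᵢ (nonzeroLeaves⇒nullity-deleteCenter SPᵢ Aᵢpp≢0)))

  allows-center : ∀ {n k} → suc k ≤ n → Allows ℝ (star n) zero k (suc k)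
  allows-center {k = k} k<n = starMatrix d , starMatrix-InS d ,
    starNullity (starMatrix-StarPattern d) isD zp , ZeroPattern-nullity isD zp
    where
    d : Vector ℝ _
    d = prefixZeros (suc k)
    isD : IsDiagonal (diagonalMatrix d) d
    isD = diagonalMatrix-IsDiagonal d
    zp : ZeroPattern d (suc k)
    zp = prefixZeros-ZeroPattern k<n

  leafDeleted-nullity : ∀ {m ℓ} (i : Fin (suc m)) e → suc ℓ ≤ m →
                        Nullity ℝ (deleteRC ℝ (suc i) (starMatrix (insertAt (prefixZeros (suc ℓ)) i e))) ℓ
  leafDeleted-nullity {ℓ = ℓ} i e ℓ<m = starNullity (StarPattern-deleteLeaf (starMatrix-StarPattern d) i)
    (IsDiagonal-deleteRC (diagonalMatrix-IsDiagonal d) i (insertAt-punchIn (prefixZeros (suc ℓ)) i e))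
    (prefixZeros-ZeroPattern ℓ<m)
    where d = insertAt (prefixZeros (suc ℓ)) i e

  allows-leaf-equal : ∀ {m ℓ} (i : Fin (suc m)) → suc ℓ ≤ m → Allows ℝ (star (suc m)) (suc i) ℓ ℓ
  allows-leaf-equal {ℓ = ℓ} i ℓ<m = starMatrix d , starMatrix-InS d ,
    starNullity (starMatrix-StarPattern d) (diagonalMatrix-IsDiagonal d)
      (ZeroPattern-insertAt-nonzero (prefixZeros-ZeroPattern ℓ<m) i 1≢0) ,
    leafDeleted-nullity i 1# ℓ<m
    where d = insertAt (prefixZeros (suc ℓ)) i 1#

  allows-leaf-suc : ∀ {m ℓ} (i : Fin (suc m)) → suc ℓ ≤ m → Allows ℝ (star (suc m)) (suc i) (suc ℓ) ℓ
  allows-leaf-suc {ℓ = ℓ} i ℓ<m = starMatrix d , starMatrix-InS d ,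
    starNullity (starMatrix-StarPattern d) (diagonalMatrix-IsDiagonal d)
      (ZeroPattern-insertAt-zero (prefixZeros-ZeroPattern ℓ<m) i) ,
    leafDeleted-nullity i 0# ℓ<m
    where d = insertAt (prefixZeros (suc ℓ)) i 0#

open import Data.Nat using (_+_)
open import Data.Nat.Properties using (+-comm; m≤n⇒m<n∨m≡n)
open import Relation.Nullary.Decidable using (decidable-stable; _×-dec_; _⊎-dec_)

center-arithmetic : ∀ {n k ℓ} → Outside k ℓ → (suc k ≡ ℓ × ℓ ≤ n) ⊎ (ℓ ≡ 0 × k ≤ 1) →
                    2 ≤ ℓ × ℓ ≤ n × k + 1 ≡ ℓ
center-arithmetic {k = zero}  out (inj₁ (refl , _))   = contradiction (inj₂ (inj₂ (refl , refl))) out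
center-arithmetic {k = suc k} _   (inj₁ (refl , ℓ≤n)) = s≤s (s≤s z≤n) , ℓ≤n , +-comm (suc k) 1
center-arithmetic out (inj₂ (refl , z≤n))             = contradiction (inj₁ (refl , refl)) out
center-arithmetic out (inj₂ (refl , s≤s z≤n))         = contradiction (inj₂ (inj₁ (refl , refl))) out

≤∧≤suc⇒≡⊎≡+1 : ∀ {k ℓ} → ℓ ≤ k → k ≤ suc ℓ → k ≡ ℓ ⊎ k ≡ ℓ + 1
≤∧≤suc⇒≡⊎≡+1 {ℓ = ℓ} ℓ≤k k≤1+ℓ with m≤n⇒m<n∨m≡n ℓ≤k
... | inj₁ ℓ<k = inj₂ (trans (≤-antisym k≤1+ℓ ℓ<k) (+-comm 1 ℓ))
... | inj₂ ℓ≡k = inj₁ (sym ℓ≡k)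

leaf-arithmetic : ∀ {m k ℓ} → 2 ≤ m → Outside k ℓ → k ≤ suc ℓ × ((ℓ ≤ k × suc ℓ ≤ m) ⊎ ℓ ≤ 1) →
                  1 ≤ ℓ × ℓ + 2 ≤ suc m × (k ≡ ℓ ⊎ k ≡ ℓ + 1)
leaf-arithmetic {k = zero}        {zero} _ out _ = contradiction (inj₁ (refl , refl)) out
leaf-arithmetic {k = suc zero}    {zero} _ out _ = contradiction (inj₂ (inj₁ (refl , refl))) out
leaf-arithmetic {k = suc (suc _)} {zero} _ _ (s≤s () , _)
leaf-arithmetic {m} {ℓ = suc ℓ} _ _ (k≤1+ℓ , inj₁ (ℓ≤k , ℓ<m)) =
  s≤s z≤n , subst (_≤ suc m) (+-comm 2 (suc ℓ)) (s≤s ℓ<m) , ≤∧≤suc⇒≡⊎≡+1 ℓ≤k k≤1+ℓ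
leaf-arithmetic {k = zero} {suc zero} _ out (_ , inj₂ _) = contradiction (inj₂ (inj₂ (refl , refl))) out
leaf-arithmetic {k = suc k} {suc zero} 2≤m _ (k≤2 , inj₂ _) = s≤s z≤n , s≤s 2≤m , ≤∧≤suc⇒≡⊎≡+1 (s≤s z≤n) k≤2
leaf-arithmetic {ℓ = suc (suc _)} _ _ (_ , inj₂ (s≤s ()))

module _ (ℝ : RealField) where

  center-characterisation : ∀ {n} k ℓ → Outside k ℓ →
                            Allows ℝ (star n) zero k ℓ ⇔ (2 ≤ ℓ × ℓ ≤ n × k + 1 ≡ ℓ)
  center-characterisation {n} k ℓ out = mk⇔
    (λ (A , A∈S , NA , NAᵢ) → decidable-stable (2 ≤? ℓ ×-dec ℓ ≤? n ×-dec k + 1 ℕ.≟ ℓ)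
       (center-arithmetic out <$> (InS⇒StarPattern ℝ A A∈S >>= λ SP → centerPairs ℝ A SP NA NAᵢ)))
    λ { (_ , ℓ≤n , refl) → subst (Allows ℝ (star n) zero k) (+-comm 1 k)
                                 (allows-center ℝ (subst (_≤ n) (+-comm k 1) ℓ≤n)) }

  leaf-characterisation : ∀ {m} → 2 ≤ m → ∀ (i : Fin (suc m)) k ℓ → Outside k ℓ →
                          Allows ℝ (star (suc m)) (suc i) k ℓ ⇔ (1 ≤ ℓ × ℓ + 2 ≤ suc m × (k ≡ ℓ ⊎ k ≡ ℓ + 1))
  leaf-characterisation {m} 2≤m i k ℓ out = mk⇔
    (λ (A , A∈S , NA , NAᵢ) → decidable-stable (1 ≤? ℓ ×-dec ℓ + 2 ≤? suc m ×-dec (k ℕ.≟ ℓ ⊎-dec k ℕ.≟ ℓ + 1))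
       (leaf-arithmetic 2≤m out <$> (InS⇒StarPattern ℝ A A∈S >>= λ SP → leafPairs ℝ A i SP NA NAᵢ)))
    λ { (_ , ℓ+2≤n , inj₁ refl) → allows-leaf-equal ℝ i (ℓ<m ℓ+2≤n)
      ; (_ , ℓ+2≤n , inj₂ refl) → subst (λ k → Allows ℝ (star (suc m)) (suc i) k ℓ) (+-comm 1 ℓ)
                                        (allows-leaf-suc ℝ i (ℓ<m ℓ+2≤n)) }
    where
    ℓ<m : ℓ + 2 ≤ suc m → suc ℓ ≤ m
    ℓ<m ℓ+2≤n = ℕ.s≤s⁻¹ (subst (_≤ suc m) (+-comm ℓ 2) ℓ+2≤n)

proposition4p6 : (ℝ : RealField) (n : ℕ) → 3 ≤ n →
    (∀ k ℓ → Outside k ℓ →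
      (Allows ℝ (star n) zero k ℓ ⇔ (2 ≤ ℓ × ℓ ≤ n × k + 1 ≡ ℓ))) ×
    (∀ (i : Fin n) k ℓ → Outside k ℓ →
      (Allows ℝ (star n) (suc i) k ℓ ⇔ (1 ≤ ℓ × ℓ + 2 ≤ n × (k ≡ ℓ ⊎ k ≡ ℓ + 1))))
proposition4p6 ℝ (suc m) (s≤s 2≤m) = center-characterisation ℝ , leaf-characterisation ℝ 2≤m
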